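{- There is a polynomial $\mathbf{ResS}$ refutation of $\mathit{SPHP}^0$: for every $m\ge1$ there is a proof $\mathit{SPHP}^0_m\vdash_{\mathbf{ResS}}\{(\Box,m^2+m+1)\}$ whose length is bounded by a polynomial in $m$ (note $\mathrm{MaxSAT}(\mathit{SPHP}^0_m)=m^2+m+1$).
   Context: A literal is a Boolean variable $x$ or its negation $\overline x$; a clause is a disjunction of literals ($\Box$ is the empty clause). Weights are elements of $\mathbb{R}_{>0}\cup\{\infty\}$. A MaxSAT formula is a finite collection of weighted clauses $(C,w)$, where $(C,u),(C,v)$ may be merged into $(C,u+v)$ and conversely, and weight-$0$ clauses disappear. Cost of an assignment is the sum of weights of falsified clauses; $\mathrm{MaxSAT}(\mathcal F)$ is the minimum cost. $\mathcal G\subseteq\mathcal H$ means every $(C,w)\in\mathcal G$ has some $(C,w')\in\mathcal H$ with $w\le w'$. A proof is a sequence $\mathcal F_0;\dots;\mathcal F_e$ (length $e$), each obtained from the previous by one rule application replacing antecedents by consequents; $\mathcal F\vdash_{\mathbf{ResS}}\mathcal G$ means such a proof with $\mathcal F_0=\mathcal F$ and $\mathcal G\subseteq\mathcal F_e$. $\mathbf{ResS}$ rules: Resolution: from $(x\lor A,v),(\overline x\lor B,w)$ ($A,B$ possibly empty), with $m'=\min\{v,w\}$, derive $(A\lor B,m'),(x\lor A,v-m'),(\overline x\lor B,w-m'),(x\lor A\lor\overline B,m'),(\overline x\lor B\lor\overline A,m')$, where for $D=l_1\lor\dots\lor l_p$ the expression $(E\lor\overline D,u)$ stands for $(E\lor\overline{l_1},u),(E\lor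 l_1\lor\overline{l_2},u),\dots,(E\lor l_1\lor\dots\lor l_{p-1}\lor\overline{l_p},u)$ (nothing if $D$ is empty), tautologies discarded. Split: from $(A,w)$ derive $(A\lor x,w),(A\lor\overline x,w)$. For $m\ge1$ take variables $x_{ij}$, $1\le i\le m+1$, $1\le j\le m$; let $\mathcal K_m$ consist of the clauses $x_{i1}\lor\dots\lor x_{im}$ for each $i$ and $\overline x_{ij}\lor\overline x_{i'j}$ for each $j$ and $1\le i<i'\le m+1$. $\mathit{SPHP}^0_m=\{(C,1)\mid C\in\mathcal K_m\}\cup\{(\Box,m^2+m)\}$. -}

module Defs where

open import Data.Bool using (Bool; true; false; _∧_; _∨_; not; if_then_else_)
open import Data.Nat as ℕ using (ℕ; zero; suc; _*_; _^_; _∸_)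
import Data.Nat.Properties as ℕP
open import Data.Product using (_×_; _,_; Σ; ∃; ∃-syntax; proj₁; proj₂)
open import Data.Product.Properties using (≡-dec)
open import Data.List using (List; []; _∷_; _++_; [_]; map; filter; concatMap; applyUpTo; foldr)
open import Data.Bool.ListAction using (any; all)
open import Data.List.Relation.Unary.All using (All)
open import Data.Rational using (ℚ; 0ℚ; 1ℚ; _+_; _-_; _⊓_; _≤_; _<_)
import Data.Rational as ℚ
open import Data.Integer using (+_)
open import Relation.Nullary.Decidable using (⌊_⌋)
open import Relation.Binary.PropositionalEquality using (_≡_)

-- Variables are indexed by pairs of naturals; x_{ij} is (i , j).
-- (Infinitely many variables are available, e.g. for the Split rule.)
Var : Set
Var = ℕ × ℕ

_≟V_ : (x y : Var) → Bool
x ≟V y = ⌊ ≡-dec ℕP._≟_ ℕP._≟_ x y ⌋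

data Lit : Set where
  pos : Var → Lit
  neg : Var → Lit

compl : Lit → Lit
compl (pos x) = neg x
compl (neg x) = pos x

_≟L_ : Lit → Lit → Bool
pos x ≟L pos y = x ≟V y
neg x ≟L neg y = x ≟V y
_ ≟L _ = false

-- A clause is a disjunction of literals, represented by a list; order and
-- repetitions are irrelevant (clauses are compared as sets of literals).
-- The empty list is the empty clause □.
Clause : Set
Clause = List Lit

□ : Clause
□ = []

memb : Lit → Clause → Bool
memb l C = any (l ≟L_) C

subC : Clause → Clause → Bool
subC C D = all (λ l → memb l D) C

sameC : Clause → Clause → Bool
sameC C D = subC C D ∧ subC D C

taut : Clause → Bool
taut C = any (λ l → memb (compl l) C) C

WClause : Set
WClause = Clause × ℚ

-- A formula is a finite list of weighted clauses, considered up to merging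
-- (C,u),(C,v) ~ (C,u+v) and deletion of weight-0 clauses: i.e. only the
-- total weight of each clause matters.
Formula : Set
Formula = List WClause

sumℚ : List ℚ → ℚ
sumℚ = foldr _+_ 0ℚ

wt : Formula → Clause → ℚ
wt F C = sumℚ (map proj₂ (filter (λ p → Data.Bool.T? (sameC (proj₁ p) C)) F))
  where import Data.Bool

_≋_ : Formula → Formula → Set
F ≋ G = ∀ C → wt F C ≡ wt G C

_⊑_ : Formula → Formula → Set
G ⊑ H = ∀ C → wt G C ≤ wt H C

NonNeg : Formula → Set
NonNeg F = All (λ p → 0ℚ ≤ proj₂ p) F

dropTaut : Formula → Formula
dropTaut = filter (λ p → Data.Bool.T? (not (taut (proj₁ p))))
  where import Data.Bool

-- (E ∨ ¬D, u) for D = l1 ∨ ... ∨ lp: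
-- (E ∨ ¬l1,u), (E ∨ l1 ∨ ¬l2,u), ..., (E ∨ l1 ∨ ... ∨ l_{p-1} ∨ ¬lp,u)
orNeg : Clause → Clause → ℚ → Formula
orNeg E []      u = []
orNeg E (l ∷ D) u = (E ++ [ compl l ] , u) ∷ orNeg (E ++ [ l ]) D u

resCons : Var → Clause → Clause → ℚ → ℚ → Formula
resCons x A B v w =
  let m′ = v ⊓ w in
  dropTaut ( (A ++ B , m′)
           ∷ (pos x ∷ A , v - m′)
           ∷ (neg x ∷ B , w - m′)
           ∷ (orNeg (pos x ∷ A) B m′ ++ orNeg (neg x ∷ B) A m′))

data Rule : Formula → Formula → Set where
  resolution : (x : Var) (A B : Clause) (v w : ℚ) → 0ℚ < v → 0ℚ < w →
    Rule ((pos x ∷ A , v) ∷ (neg x ∷ B , w) ∷ []) (resCons x A B v w)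
  split : (A : Clause) (x : Var) (w : ℚ) → 0ℚ < w →
    Rule ((A , w) ∷ []) (dropTaut ((A ++ [ pos x ] , w) ∷ (A ++ [ neg x ] , w) ∷ []))

Step : Formula → Formula → Set
Step F G = ∃[ Ants ] ∃[ Cons ] ∃[ R ]
  (Rule Ants Cons × NonNeg R × F ≋ (Ants ++ R) × G ≋ (Cons ++ R))

data Proof : ℕ → Formula → Formula → Set where
  done : ∀ {F} → Proof 0 F F
  step : ∀ {e F G H} → Step F G → Proof e G H → Proof (suc e) F H

Derives : ℕ → Formula → Formula → Set
Derives e F G = ∃[ H ] (Proof e F H × G ⊑ H)

ℕtoℚ : ℕ → ℚ
ℕtoℚ n = + n ℚ./ 1

range1 : ℕ → List ℕ
range1 n = applyUpTo suc n

x : ℕ → ℕ → Var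
x i j = (i , j)

K : ℕ → List Clause
K m = map (λ i → map (λ j → pos (x i j)) (range1 m)) (range1 (suc m))
   ++ concatMap (λ j → concatMap (λ i →
        map (λ i′ → neg (x i j) ∷ neg (x i′ j) ∷ [])
            (applyUpTo (λ k → i ℕ.+ suc k) (suc m ∸ i)))
        (range1 (suc m))) (range1 m)

SPHP0 : ℕ → Formula
SPHP0 m = map (λ C → (C , 1ℚ)) (K m) ++ [ (□ , ℕtoℚ (m * m ℕ.+ m)) ]

-- The weight m² + m of □ is split into the m(m + 1) pairs of unit clauses xᵢⱼ, ¬xᵢⱼ.
-- For a hole j, the units x₁ⱼ, …, xₘ₊₁,ⱼ and the clauses ¬xᵢⱼ ∨ ¬xᵢ′ⱼ absorb one unit at
-- a time into x₁ⱼ ∨ … ∨ xₘ₊₁,ⱼ, each absorption producing one □; this gives m copies of □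
-- per hole. For a pigeon i, the clause xᵢ₁ ∨ … ∨ xᵢₘ is resolved against ¬xᵢ₁, …, ¬xᵢₘ
-- down to □. Altogether m·m + (m + 1) copies of □ appear, after O(m³) rule applications.

module Submission where

open import Defs
open import Algebra.Bundles using (CommutativeSemigroup)
import Algebra.Properties.CommutativeSemigroup as CommSemigroupProperties
open import Data.Bool using (true; false; T; T?; not; if_then_else_)
open import Data.Bool.Properties using (T-∧; T-not-≡; T-≡; ¬-not)
open import Data.Empty using (⊥-elim)
open import Data.Integer using (+_)
import Data.Integer as ℤ
import Data.Integer.Properties as ℤ
open import Data.List using (List; []; _∷_; _++_; [_]; map; concatMap; applyUpTo; length)
import Data.List.Properties as List
open import Data.List.Membership.Propositional using (_∈_; _∉_; find)
open import Data.List.Membership.Propositional.Properties using (∈-map⁻; ∈-++⁻)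
open import Data.List.Relation.Binary.Permutation.Propositional using (_↭_; ↭-sym; swap; refl)
open import Data.List.Relation.Binary.Permutation.Propositional.Properties using (++-comm)
open import Data.List.Relation.Binary.Subset.Propositional using (_⊆_)
open import Data.List.Relation.Binary.Subset.Propositional.Properties using (⊆-reflexive-↭; xs⊆xs++ys; xs⊆ys++xs)
open import Data.List.Relation.Unary.All as All using (All; []; _∷_)
open import Data.List.Relation.Unary.All.Properties using (all⁺; all⁻; ++⁺)
open import Data.List.Relation.Unary.AllPairs using (_∷_)
open import Data.List.Relation.Unary.Any as Any using (here; there)
open import Data.List.Relation.Unary.Any.Properties using (any⁺; any⁻)
open import Data.List.Relation.Unary.Unique.Propositional using (Unique)
open import Data.List.Relation.Unary.Unique.Propositional.Properties using (Unique[x∷xs]⇒x∉xs; map⁺; applyUpTo⁺₁)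
open import Data.Nat using (ℕ; zero; suc; _≤_; _*_; _+_; _^_; _∸_; z≤n)
import Data.Nat.Properties as ℕ
open import Data.Nat.Divisibility using (∣1⇒≡1)
open import Data.Nat.Tactic.RingSolver using (solve-∀)
open import Data.Product using (_×_; _,_; ∃-syntax; proj₁; proj₂)
open import Data.Product.Properties using (≡-dec)
open import Data.Rational using (ℚ; 0ℚ; 1ℚ; mkℚ; _/_)
import Data.Rational as ℚ
import Data.Rational.Properties as ℚ
open import Data.Sum using (inj₁; inj₂; [_,_]′)
open import Function using (_∘_; id; Equivalence)
open import Relation.Binary.Bundles using (Setoid)
open import Relation.Binary.Structures using (IsEquivalence)
open import Relation.Binary.PropositionalEquality as ≡ using (_≡_; cong; cong₂; subst)
open import Relation.Nullary.Decidable using (fromWitness; toWitness)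

≟V-refl : ∀ v → T (v ≟V v)
≟V-refl v = fromWitness {a? = ≡-dec ℕ._≟_ ℕ._≟_ v v} ≡.refl

≟V-sound : ∀ u v → T (u ≟V v) → u ≡ v
≟V-sound u v = toWitness {a? = ≡-dec ℕ._≟_ ℕ._≟_ u v}

≟L-refl : ∀ l → T (l ≟L l)
≟L-refl (pos v) = ≟V-refl v
≟L-refl (neg v) = ≟V-refl v

≟L-sound : ∀ l k → T (l ≟L k) → l ≡ k
≟L-sound (pos u) (pos v) = cong pos ∘ ≟V-sound u v
≟L-sound (neg u) (neg v) = cong neg ∘ ≟V-sound u v

memb⁺ : ∀ {l C} → l ∈ C → T (memb l C)
memb⁺ {l} = any⁺ _ ∘ Any.map λ { ≡.refl → ≟L-refl l }

memb⁻ : ∀ {l C} → T (memb l C) → l ∈ C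
memb⁻ {l} {C} = Any.map (≟L-sound l _) ∘ any⁻ _ C

subC⁺ : ∀ {C D} → C ⊆ D → T (subC C D)
subC⁺ C⊆D = all⁻ _ (All.tabulate (memb⁺ ∘ C⊆D))

subC⁻ : ∀ C D → T (subC C D) → C ⊆ D
subC⁻ C D t = memb⁻ ∘ All.lookup (all⁺ _ C t)

sameC⁺ : ∀ {C D} → C ⊆ D → D ⊆ C → T (sameC C D)
sameC⁺ C⊆D D⊆C = Equivalence.from T-∧ (subC⁺ C⊆D , subC⁺ D⊆C)

sameC⁻ : ∀ C D → T (sameC C D) → C ⊆ D × D ⊆ C
sameC⁻ C D t = let C⊆D , D⊆C = Equivalence.to T-∧ t in subC⁻ C D C⊆D , subC⁻ D C D⊆C

T-ext : ∀ {a b} → (T a → T b) → (T b → T a) → a ≡ b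
T-ext {false} {false} _ _ = ≡.refl
T-ext {false} {true}  _ g = ⊥-elim (g _)
T-ext {true}  {false} f _ = ⊥-elim (f _)
T-ext {true}  {true}  _ _ = ≡.refl

sameC-cong : ∀ {C D} E → C ⊆ D → D ⊆ C → sameC C E ≡ sameC D E
sameC-cong {C} {D} E C⊆D D⊆C = T-ext
  (λ t → let C⊆E , E⊆C = sameC⁻ C E t in sameC⁺ (C⊆E ∘ D⊆C) (C⊆D ∘ E⊆C))
  (λ t → let D⊆E , E⊆D = sameC⁻ D E t in sameC⁺ (D⊆E ∘ C⊆D) (D⊆C ∘ E⊆D))

NonTautological : Clause → Set
NonTautological C = ∀ {l} → l ∈ C → compl l ∉ C

nonTautological⇒¬taut : ∀ {C} → NonTautological C → T (not (taut C))
nonTautological⇒¬taut {C} nt = Equivalence.from T-not-≡ (¬-not λ taut≡true →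
  let _ , l∈C , compl-l∈C = find (any⁻ _ C (Equivalence.from T-≡ taut≡true)) in
  nt l∈C (memb⁻ compl-l∈C))

nonTautological-⊆ : ∀ {C D} → C ⊆ D → NonTautological D → NonTautological C
nonTautological-⊆ C⊆D nt l∈C compl-l∈C = nt (C⊆D l∈C) (C⊆D compl-l∈C)

neg∉positive : ∀ v vs → neg v ∉ map pos vs
neg∉positive v vs neg-v∈ with ∈-map⁻ pos neg-v∈
... | _ , _ , ()

positive-nonTautological : ∀ vs → NonTautological (map pos vs)
positive-nonTautological vs l∈ with ∈-map⁻ pos l∈
... | v , _ , ≡.refl = neg∉positive v vs

positive∨neg-nonTautological : ∀ vs u → u ∉ vs → NonTautological (map pos vs ++ [ neg u ])
positive∨neg-nonTautological vs u u∉vs l∈ compl-l∈ with ∈-++⁻ (map pos vs) l∈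
... | inj₁ pos-v∈ with ∈-map⁻ pos pos-v∈
...   | v , v∈vs , ≡.refl with ∈-++⁻ (map pos vs) compl-l∈
...     | inj₁ neg-v∈ = neg∉positive v vs neg-v∈
...     | inj₂ (here ≡.refl) = u∉vs v∈vs
positive∨neg-nonTautological vs u u∉vs l∈ compl-l∈ | inj₂ (here ≡.refl) with ∈-++⁻ (map pos vs) compl-l∈
... | inj₂ (here ())
... | inj₁ pos-u∈ with ∈-map⁻ pos pos-u∈
...   | v , v∈vs , ≡.refl = u∉vs v∈vs

weightIn : Clause → WClause → ℚ
weightIn C (D , w) = if sameC D C then w else 0ℚ

wt-∷ : ∀ D w F C → wt ((D , w) ∷ F) C ≡ weightIn C (D , w) ℚ.+ wt F C
wt-∷ D w F C with sameC D C
... | true  = ≡.refl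
... | false = ≡.sym (ℚ.+-identityˡ _)

wt-++ : ∀ F G C → wt (F ++ G) C ≡ wt F C ℚ.+ wt G C
wt-++ [] G C = ≡.sym (ℚ.+-identityˡ _)
wt-++ ((D , w) ∷ F) G C = begin
  wt ((D , w) ∷ F ++ G) C                    ≡⟨ wt-∷ D w (F ++ G) C ⟩
  weightIn C (D , w) ℚ.+ wt (F ++ G) C        ≡⟨ cong (weightIn C (D , w) ℚ.+_) (wt-++ F G C) ⟩
  weightIn C (D , w) ℚ.+ (wt F C ℚ.+ wt G C)  ≡⟨ ℚ.+-assoc (weightIn C (D , w)) (wt F C) (wt G C) ⟨
  (weightIn C (D , w) ℚ.+ wt F C) ℚ.+ wt G C  ≡⟨ cong (ℚ._+ wt G C) (wt-∷ D w F C) ⟨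
  wt ((D , w) ∷ F) C ℚ.+ wt G C               ∎
  where open ≡.≡-Reasoning

infix 4 _≈_

record _≈_ (F G : Formula) : Set where
  constructor mk≈
  field wt-≡ : F ≋ G
open _≈_

≈-isEquivalence : IsEquivalence _≈_
≈-isEquivalence = record
  { refl  = mk≈ λ _ → ≡.refl
  ; sym   = λ F≈G → mk≈ λ C → ≡.sym (wt-≡ F≈G C)
  ; trans = λ F≈G G≈H → mk≈ λ C → ≡.trans (wt-≡ F≈G C) (wt-≡ G≈H C)
  }

≈-setoid : Setoid _ _
≈-setoid = record { isEquivalence = ≈-isEquivalence }

open IsEquivalence ≈-isEquivalence public
  using () renaming (refl to ≈-refl; sym to ≈-sym; trans to ≈-trans; reflexive to ≡⇒≈)

++-cong : ∀ {F F′ G G′} → F ≈ F′ → G ≈ G′ → F ++ G ≈ F′ ++ G′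
++-cong {F} {F′} {G} {G′} F≈F′ G≈G′ = mk≈ λ C → begin
  wt (F ++ G) C        ≡⟨ wt-++ F G C ⟩
  wt F C ℚ.+ wt G C    ≡⟨ cong₂ ℚ._+_ (wt-≡ F≈F′ C) (wt-≡ G≈G′ C) ⟩
  wt F′ C ℚ.+ wt G′ C  ≡⟨ wt-++ F′ G′ C ⟨
  wt (F′ ++ G′) C      ∎
  where open ≡.≡-Reasoning

++-comm-≈ : ∀ F G → F ++ G ≈ G ++ F
++-comm-≈ F G = mk≈ λ C → begin
  wt (F ++ G) C      ≡⟨ wt-++ F G C ⟩
  wt F C ℚ.+ wt G C  ≡⟨ ℚ.+-comm (wt F C) (wt G C) ⟩
  wt G C ℚ.+ wt F C  ≡⟨ wt-++ G F C ⟨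
  wt (G ++ F) C      ∎
  where open ≡.≡-Reasoning

++-assoc-≈ : ∀ F G H → (F ++ G) ++ H ≈ F ++ (G ++ H)
++-assoc-≈ F G H = ≡⇒≈ (List.++-assoc F G H)

++-≈-commutativeSemigroup : CommutativeSemigroup _ _
++-≈-commutativeSemigroup = record
  { _≈_ = _≈_
  ; _∙_ = _++_
  ; isCommutativeSemigroup = record
    { isSemigroup = record
      { isMagma = record { isEquivalence = ≈-isEquivalence ; ∙-cong = ++-cong }
      ; assoc   = ++-assoc-≈
      }
    ; comm = ++-comm-≈
    }
  }

open CommSemigroupProperties ++-≈-commutativeSemigroup using (interchange; xy∙z≈xz∙y; x∙yz≈y∙xz; x∙yz≈xz∙y)

≈-clause : ∀ {C D} w → C ⊆ D → D ⊆ C → [ (C , w) ] ≈ [ (D , w) ]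
≈-clause {C} {D} w C⊆D D⊆C = mk≈ λ E → begin
  wt [ (C , w) ] E                      ≡⟨ wt-∷ C w [] E ⟩
  weightIn E (C , w) ℚ.+ 0ℚ             ≡⟨ cong (λ b → (if b then w else 0ℚ) ℚ.+ 0ℚ) (sameC-cong E C⊆D D⊆C) ⟩
  weightIn E (D , w) ℚ.+ 0ℚ             ≡⟨ wt-∷ D w [] E ⟨
  wt [ (D , w) ] E                      ∎
  where open ≡.≡-Reasoning

≈-clause-↭ : ∀ {C D} w → C ↭ D → [ (C , w) ] ≈ [ (D , w) ]
≈-clause-↭ w C↭D = ≈-clause w (⊆-reflexive-↭ C↭D) (⊆-reflexive-↭ (↭-sym C↭D))

≈-weight-0 : ∀ C → [ (C , 0ℚ) ] ≈ []
≈-weight-0 C = mk≈ λ E → ≡.trans (wt-∷ C 0ℚ [] E) (vanishes E)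
  where
  vanishes : ∀ E → weightIn E (C , 0ℚ) ℚ.+ 0ℚ ≡ 0ℚ
  vanishes E with sameC C E
  ... | true  = ≡.refl
  ... | false = ≡.refl

≈-merge : ∀ C u v → (C , u) ∷ [ (C , v) ] ≈ [ (C , u ℚ.+ v) ]
≈-merge C u v = mk≈ λ E → begin
  wt ((C , u) ∷ [ (C , v) ]) E                         ≡⟨ wt-∷ C u _ E ⟩
  weightIn E (C , u) ℚ.+ wt [ (C , v) ] E              ≡⟨ cong (weightIn E (C , u) ℚ.+_) (wt-∷ C v [] E) ⟩
  weightIn E (C , u) ℚ.+ (weightIn E (C , v) ℚ.+ 0ℚ)   ≡⟨ merged E ⟩
  weightIn E (C , u ℚ.+ v) ℚ.+ 0ℚ                      ≡⟨ wt-∷ C (u ℚ.+ v) [] E ⟨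
  wt [ (C , u ℚ.+ v) ] E                               ∎
  where
  open ≡.≡-Reasoning
  merged : ∀ E → weightIn E (C , u) ℚ.+ (weightIn E (C , v) ℚ.+ 0ℚ) ≡ weightIn E (C , u ℚ.+ v) ℚ.+ 0ℚ
  merged E with sameC C E
  ... | true  = ≡.sym (ℚ.+-assoc u v 0ℚ)
  ... | false = ≡.refl

0<1 : 0ℚ ℚ.< 1ℚ
0<1 = ℚ.positive⁻¹ 1ℚ

0≤1 : 0ℚ ℚ.≤ 1ℚ
0≤1 = ℚ.nonNegative⁻¹ 1ℚ

weightIn-nonNeg : ∀ C p → 0ℚ ℚ.≤ proj₂ p → 0ℚ ℚ.≤ weightIn C p
weightIn-nonNeg C (D , w) 0≤w with sameC D C
... | true  = 0≤w
... | false = ℚ.≤-refl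

wt-nonNeg : ∀ F C → NonNeg F → 0ℚ ℚ.≤ wt F C
wt-nonNeg [] C [] = ℚ.≤-refl
wt-nonNeg ((D , w) ∷ F) C (0≤w ∷ nonNeg) rewrite wt-∷ D w F C =
  ℚ.+-mono-≤ (weightIn-nonNeg C (D , w) 0≤w) (wt-nonNeg F C nonNeg)

⊑-++-nonNeg : ∀ G R → NonNeg R → G ⊑ (G ++ R)
⊑-++-nonNeg G R nonNeg C rewrite wt-++ G R C =
  subst (ℚ._≤ wt G C ℚ.+ wt R C) (ℚ.+-identityʳ (wt G C))
    (ℚ.+-monoʳ-≤ (wt G C) (wt-nonNeg R C nonNeg))

NonNeg-concatMap : ∀ {A : Set} (F : A → Formula) (L : List A) → (∀ a → NonNeg (F a)) → NonNeg (concatMap F L)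
NonNeg-concatMap F []      _      = []
NonNeg-concatMap F (a ∷ L) nonNeg = ++⁺ (nonNeg a) (NonNeg-concatMap F L nonNeg)

NonNeg-unitWeights : ∀ {A : Set} (C : A → Clause) (L : List A) → NonNeg (map (λ a → (C a , 1ℚ)) L)
NonNeg-unitWeights C []      = []
NonNeg-unitWeights C (a ∷ L) = 0≤1 ∷ NonNeg-unitWeights C L

-- Derivations

step-respˡ : ∀ {F F′ G} → F ≈ F′ → Step F G → Step F′ G
step-respˡ {F} F≈F′ (Ants , Cons , R , rule , nonNeg , F≋ , G≋) =
  Ants , Cons , R , rule , nonNeg , wt-≡ (≈-trans (≈-sym F≈F′) (mk≈ {F} {Ants ++ R} F≋)) , G≋

step-frame : ∀ {F G S} → NonNeg S → Step F G → Step (F ++ S) (G ++ S)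
step-frame {F} {G} {S} nonNegS (Ants , Cons , R , rule , nonNeg , F≋ , G≋) =
  Ants , Cons , R ++ S , rule , ++⁺ nonNeg nonNegS ,
  wt-≡ (≈-trans (++-cong (mk≈ {F} {Ants ++ R} F≋) (≈-refl {S})) (++-assoc-≈ Ants R S)) ,
  wt-≡ (≈-trans (++-cong (mk≈ {G} {Cons ++ R} G≋) (≈-refl {S})) (++-assoc-≈ Cons R S))

proof-frame : ∀ {e F H S} → NonNeg S → Proof e F H → Proof e (F ++ S) (H ++ S)
proof-frame nonNegS done       = done
proof-frame {F = F} {S = S} nonNegS (step {G = G} s p) =
  step (step-frame {F} {G} {S} nonNegS s) (proof-frame nonNegS p)

proof-++ : ∀ {e₁ e₂ F G H} → Proof e₁ F G → Proof e₂ G H → Proof (e₁ + e₂) F H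
proof-++ done       q = q
proof-++ (step s p) q = step s (proof-++ p q)

-- Unlike Derives, the nonnegative leftover R is kept explicit; this is what makes
-- derivations compose.
infix 3 _⊢[_]_

_⊢[_]_ : Formula → ℕ → Formula → Set
F ⊢[ e ] G = ∃[ H ] (Proof e F H × ∃[ R ] (NonNeg R × H ≈ G ++ R))

⊢⇒Derives : ∀ {e F G} → F ⊢[ e ] G → Derives e F G
⊢⇒Derives {G = G} (H , proof , R , nonNeg , H≈G++R) =
  H , proof , λ C → subst (wt G C ℚ.≤_) (≡.sym (wt-≡ H≈G++R C)) (⊑-++-nonNeg G R nonNeg C)

⊢-reflexive : ∀ {F G} → F ≈ G → F ⊢[ 0 ] G
⊢-reflexive {F} {G} F≈G = F , done , [] , [] , ≈-trans F≈G (≡⇒≈ (≡.sym (List.++-identityʳ G)))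

⊢-step : ∀ {F G} → Step F G → F ⊢[ 1 ] G
⊢-step {G = G} s = G , step s done , [] , [] , ≡⇒≈ (≡.sym (List.++-identityʳ G))

⊢-respˡ : ∀ {e F F′ G} → F ≈ F′ → F ⊢[ e ] G → F′ ⊢[ e ] G
⊢-respˡ {F′ = F′} F≈F′ (H , done , R , nonNeg , H≈) = F′ , done , R , nonNeg , ≈-trans (≈-sym F≈F′) H≈
⊢-respˡ {F = F} {F′} F≈F′ (H , step {G = G} s p , rest) = H , step (step-respˡ {F} {F′} {G} F≈F′ s) p , rest

⊢-respʳ : ∀ {e F G G′} → G ≈ G′ → F ⊢[ e ] G → F ⊢[ e ] G′
⊢-respʳ G≈G′ (H , p , R , nonNeg , H≈) = H , p , R , nonNeg , ≈-trans H≈ (++-cong G≈G′ ≈-refl)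

⊢-weaken : ∀ {e F G G′ S} → G ≈ G′ ++ S → NonNeg S → F ⊢[ e ] G → F ⊢[ e ] G′
⊢-weaken {G′ = G′} {S} G≈ nonNegS (H , p , R , nonNeg , H≈) =
  H , p , S ++ R , ++⁺ nonNegS nonNeg , ≈-trans H≈ (≈-trans (++-cong G≈ ≈-refl) (++-assoc-≈ G′ S R))

⊢-frameʳ : ∀ {e F G S} → NonNeg S → F ⊢[ e ] G → F ++ S ⊢[ e ] G ++ S
⊢-frameʳ {G = G} {S} nonNegS (H , p , R , nonNeg , H≈) =
  H ++ S , proof-frame nonNegS p , R , nonNeg , ≈-trans (++-cong H≈ ≈-refl) (xy∙z≈xz∙y G R S)

⊢-frameˡ : ∀ {e F G S} → NonNeg S → F ⊢[ e ] G → S ++ F ⊢[ e ] S ++ G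
⊢-frameˡ {F = F} {G} {S} nonNegS d = ⊢-respʳ (++-comm-≈ G S) (⊢-respˡ (++-comm-≈ F S) (⊢-frameʳ nonNegS d))

⊢-trans : ∀ {e₁ e₂ F G H} → F ⊢[ e₁ ] G → G ⊢[ e₂ ] H → F ⊢[ e₁ + e₂ ] H
⊢-trans (H₁ , p₁ , R₁ , nonNeg₁ , H₁≈) d
  with ⊢-weaken ≈-refl nonNeg₁ (⊢-respˡ (≈-sym H₁≈) (⊢-frameʳ nonNeg₁ d))
... | H₂ , p₂ , rest = H₂ , proof-++ p₁ p₂ , rest

⊢-++ : ∀ {e₁ e₂ F₁ F₂ G₁ G₂} → NonNeg F₂ → NonNeg G₁ →
       F₁ ⊢[ e₁ ] G₁ → F₂ ⊢[ e₂ ] G₂ → F₁ ++ F₂ ⊢[ e₁ + e₂ ] G₁ ++ G₂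
⊢-++ nonNegF₂ nonNegG₁ d₁ d₂ = ⊢-trans (⊢-frameʳ nonNegF₂ d₁) (⊢-frameˡ nonNegG₁ d₂)

⊢-concatMap : ∀ {A : Set} {e} (F G : A → Formula) (L : List A) →
              (∀ a → NonNeg (F a)) → (∀ a → NonNeg (G a)) → (∀ a → F a ⊢[ e ] G a) →
              concatMap F L ⊢[ length L * e ] concatMap G L
⊢-concatMap F G []      _ _ _ = ⊢-reflexive ≈-refl
⊢-concatMap F G (a ∷ L) nonNegF nonNegG d =
  ⊢-++ (NonNeg-concatMap F L nonNegF) (nonNegG a) (d a) (⊢-concatMap F G L nonNegF nonNegG d)

⊢-rule : ∀ {Ants Cons} → Rule Ants Cons → Ants ⊢[ 1 ] Cons
⊢-rule {Ants} {Cons} rule = ⊢-step (Ants , Cons , [] , rule , [] ,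
  wt-≡ (≡⇒≈ (≡.sym (List.++-identityʳ Ants))) , wt-≡ (≡⇒≈ (≡.sym (List.++-identityʳ Cons))))

dropTaut-accept : ∀ {C} w F → NonTautological C → dropTaut ((C , w) ∷ F) ≡ (C , w) ∷ dropTaut F
dropTaut-accept w F nt = List.filter-accept (λ p → T? (not (taut (proj₁ p)))) (nonTautological⇒¬taut nt)

NonNeg-dropTaut : ∀ F → NonNeg F → NonNeg (dropTaut F)
NonNeg-dropTaut [] [] = []
NonNeg-dropTaut ((C , w) ∷ F) (0≤w ∷ nonNeg) with not (taut C)
... | true  = 0≤w ∷ NonNeg-dropTaut F nonNeg
... | false = NonNeg-dropTaut F nonNeg

NonNeg-orNeg : ∀ E D → NonNeg (orNeg E D 1ℚ)
NonNeg-orNeg E []      = []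
NonNeg-orNeg E (l ∷ D) = 0≤1 ∷ NonNeg-orNeg (E ++ [ l ]) D

resolutionSideClauses : Var → Clause → Clause → Formula
resolutionSideClauses v A B =
  (pos v ∷ A , 1ℚ ℚ.- (1ℚ ℚ.⊓ 1ℚ)) ∷ (neg v ∷ B , 1ℚ ℚ.- (1ℚ ℚ.⊓ 1ℚ)) ∷
  (orNeg (pos v ∷ A) B (1ℚ ℚ.⊓ 1ℚ) ++ orNeg (neg v ∷ B) A (1ℚ ℚ.⊓ 1ℚ))

NonNeg-resolutionSideClauses : ∀ v A B → NonNeg (resolutionSideClauses v A B)
NonNeg-resolutionSideClauses v A B =
  ℚ.≤-refl ∷ ℚ.≤-refl ∷ ++⁺ (NonNeg-orNeg (pos v ∷ A) B) (NonNeg-orNeg (neg v ∷ B) A)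

⊢-resolve : ∀ v A B → NonTautological (A ++ B) →
            (pos v ∷ A , 1ℚ) ∷ [ (neg v ∷ B , 1ℚ) ] ⊢[ 1 ] [ (A ++ B , 1ℚ) ]
⊢-resolve v A B nt =
  ⊢-weaken (≡⇒≈ (dropTaut-accept 1ℚ (resolutionSideClauses v A B) nt))
    (NonNeg-dropTaut _ (NonNeg-resolutionSideClauses v A B))
    (⊢-rule (resolution v A B 1ℚ 1ℚ 0<1 0<1))

⊢-split : ∀ A v → NonTautological (A ++ [ pos v ]) → NonTautological (A ++ [ neg v ]) →
          [ (A , 1ℚ) ] ⊢[ 1 ] (A ++ [ pos v ] , 1ℚ) ∷ [ (A ++ [ neg v ] , 1ℚ) ]
⊢-split A v nt₊ nt₋ =
  ⊢-respʳ (≡⇒≈ (≡.trans (dropTaut-accept 1ℚ _ nt₊)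
                        (cong ((A ++ [ pos v ] , 1ℚ) ∷_) (dropTaut-accept 1ℚ [] nt₋))))
    (⊢-rule (split A v 1ℚ 0<1))

⊢-resolvePositives : ∀ D vs → NonTautological (map pos vs ++ D) →
  (map pos vs ++ D , 1ℚ) ∷ map (λ y → (neg y ∷ D , 1ℚ)) vs ⊢[ length vs ] [ (D , 1ℚ) ]
⊢-resolvePositives D []       nt = ⊢-reflexive ≈-refl
⊢-resolvePositives D (v ∷ vs) nt =
  ⊢-trans {1}
    (⊢-frameʳ (NonNeg-unitWeights (λ y → neg y ∷ D) vs)
      (⊢-respʳ (≈-clause 1ℚ absorb (xs⊆xs++ys (map pos vs ++ D) D))
        (⊢-resolve v (map pos vs ++ D) D (nonTautological-⊆ absorb ntᵥₛ))))
    (⊢-resolvePositives D vs ntᵥₛ)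
  where
  ntᵥₛ : NonTautological (map pos vs ++ D)
  ntᵥₛ = nonTautological-⊆ there nt
  absorb : (map pos vs ++ D) ++ D ⊆ map pos vs ++ D
  absorb = [ id , xs⊆ys++xs D (map pos vs) ]′ ∘ ∈-++⁻ (map pos vs ++ D)

□[_] : ℕ → Formula
□[ k ] = [ (□ , ℕtoℚ k) ]

ℕtoℚ≡mkℚ : ∀ n → ℕtoℚ n ≡ mkℚ (+ n) 0 (λ (_ , d∣1) → ∣1⇒≡1 d∣1)
ℕtoℚ≡mkℚ n = ℚ.normalize-coprime _

ℕtoℚ-+ : ∀ a b → ℕtoℚ (a + b) ≡ ℕtoℚ a ℚ.+ ℕtoℚ b
ℕtoℚ-+ a b rewrite ℕtoℚ≡mkℚ a | ℕtoℚ≡mkℚ b =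
  cong (_/ 1) (≡.sym (cong₂ ℤ._+_ (ℤ.*-identityʳ (+ a)) (ℤ.*-identityʳ (+ b))))

□[0]≈[] : □[ 0 ] ≈ []
□[0]≈[] = ≈-weight-0 □

□[+] : ∀ a b → □[ a + b ] ≈ □[ a ] ++ □[ b ]
□[+] a b = ≈-trans (≡⇒≈ (cong (λ w → [ (□ , w) ]) (ℕtoℚ-+ a b))) (≈-sym (≈-merge □ (ℕtoℚ a) (ℕtoℚ b)))

□[suc] : ∀ n → □[ n ] ++ [ (□ , 1ℚ) ] ≈ □[ suc n ]
□[suc] n = ≈-trans (≈-sym (□[+] n 1)) (≡⇒≈ (cong □[_] (ℕ.+-comm n 1)))

NonNeg-□ : ∀ k → NonNeg □[ k ]
NonNeg-□ k = ℚ.nonNegative⁻¹ (ℕtoℚ k) {{ℚ.normalize-nonNeg k 1}} ∷ []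

□[*] : ∀ {A : Set} (L : List A) k → □[ length L * k ] ≈ concatMap (λ _ → □[ k ]) L
□[*] []      k = □[0]≈[]
□[*] (a ∷ L) k = ≈-trans (□[+] k (length L * k)) (++-cong (≈-refl {□[ k ]}) (□[*] L k))

-- At most one of the variables vs is true

positiveUnits : List Var → Formula
positiveUnits = map (λ v → (pos v ∷ [] , 1ℚ))

exclusions : Var → List Var → Formula
exclusions u = map (λ w → (neg u ∷ neg w ∷ [] , 1ℚ))

atMostOne : List Var → Formula
atMostOne []       = []
atMostOne (v ∷ vs) = exclusions v vs ++ atMostOne vs

NonNeg-atMostOne : ∀ vs → NonNeg (atMostOne vs)
NonNeg-atMostOne []       = []
NonNeg-atMostOne (v ∷ vs) = ++⁺ (NonNeg-unitWeights (λ w → neg v ∷ neg w ∷ []) vs) (NonNeg-atMostOne vs)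

-- Split the clause ys on u; resolving ys ∨ ¬u against the exclusions of u leaves ¬u, which
-- cancels the unit u, while ys ∨ u remains.
⊢-absorbUnit : ∀ u ys → u ∉ ys →
  (map pos ys , 1ℚ) ∷ (pos u ∷ [] , 1ℚ) ∷ exclusions u ys
    ⊢[ 1 + (length ys + 1) ] (□ , 1ℚ) ∷ [ (pos u ∷ map pos ys , 1ℚ) ]
⊢-absorbUnit u ys u∉ys =
  ⊢-trans {1} splitOnU (⊢-respˡ (≈-sym regroup) (⊢-trans {length ys} resolveYs
    (⊢-respˡ (≈-sym (++-cong (++-comm-≈ [ ¬u ] [ u₁ ]) (≈-refl {[ ys∨u ]}))) (⊢-respʳ reorder cancelU))))
  where
  Y = map pos ys
  u₁ ¬u ys∨u ys∨¬u : WClause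
  u₁ = pos u ∷ [] , 1ℚ
  ¬u = neg u ∷ [] , 1ℚ
  ys∨u = Y ++ [ pos u ] , 1ℚ
  ys∨¬u = Y ++ [ neg u ] , 1ℚ
  exclusions′ = map (λ y → (neg y ∷ neg u ∷ [] , 1ℚ)) ys
  nt₋ : NonTautological (Y ++ [ neg u ])
  nt₋ = positive∨neg-nonTautological ys u u∉ys
  nt₊ : NonTautological (Y ++ [ pos u ])
  nt₊ = subst NonTautological (List.map-++ pos ys [ u ]) (positive-nonTautological (ys ++ [ u ]))
  splitOnU : (Y , 1ℚ) ∷ u₁ ∷ exclusions u ys ⊢[ 1 ] ys∨u ∷ ys∨¬u ∷ u₁ ∷ exclusions u ys
  splitOnU = ⊢-frameʳ (0≤1 ∷ NonNeg-unitWeights (λ y → neg u ∷ neg y ∷ []) ys) (⊢-split Y u nt₊ nt₋)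
  exclusions-swap : ∀ vs → exclusions u vs ≈ map (λ y → (neg y ∷ neg u ∷ [] , 1ℚ)) vs
  exclusions-swap []       = ≈-refl
  exclusions-swap (v ∷ vs) = ++-cong (≈-clause-↭ 1ℚ (swap (neg u) (neg v) refl)) (exclusions-swap vs)
  regroup : ys∨u ∷ ys∨¬u ∷ u₁ ∷ exclusions u ys ≈ (ys∨¬u ∷ exclusions′) ++ u₁ ∷ [ ys∨u ]
  regroup = begin
    [ ys∨u ] ++ ys∨¬u ∷ u₁ ∷ exclusions u ys
      ≈⟨ ++-comm-≈ [ ys∨u ] _ ⟩
    ys∨¬u ∷ ([ u₁ ] ++ exclusions u ys) ++ [ ys∨u ]
      ≈⟨ after-ys∨¬u (++-cong (++-comm-≈ [ u₁ ] (exclusions u ys)) (≈-refl {[ ys∨u ]})) ⟩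
    ys∨¬u ∷ (exclusions u ys ++ [ u₁ ]) ++ [ ys∨u ]
      ≈⟨ after-ys∨¬u (++-assoc-≈ (exclusions u ys) [ u₁ ] [ ys∨u ]) ⟩
    ys∨¬u ∷ exclusions u ys ++ u₁ ∷ [ ys∨u ]
      ≈⟨ after-ys∨¬u (++-cong (exclusions-swap ys) ≈-refl) ⟩
    (ys∨¬u ∷ exclusions′) ++ u₁ ∷ [ ys∨u ]
      ∎
    where
    open import Relation.Binary.Reasoning.Setoid ≈-setoid
    after-ys∨¬u : ∀ {F G} → F ≈ G → ys∨¬u ∷ F ≈ ys∨¬u ∷ G
    after-ys∨¬u = ++-cong (≈-refl {[ ys∨¬u ]})
  resolveYs : (ys∨¬u ∷ exclusions′) ++ u₁ ∷ [ ys∨u ] ⊢[ length ys ] [ ¬u ] ++ u₁ ∷ [ ys∨u ]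
  resolveYs = ⊢-frameʳ (0≤1 ∷ 0≤1 ∷ []) (⊢-resolvePositives (neg u ∷ []) ys nt₋)
  cancelU : (u₁ ∷ [ ¬u ]) ++ [ ys∨u ] ⊢[ 1 ] [ (□ , 1ℚ) ] ++ [ ys∨u ]
  cancelU = ⊢-frameʳ (0≤1 ∷ []) (⊢-resolve u [] [] λ ())
  reorder : [ (□ , 1ℚ) ] ++ [ ys∨u ] ≈ (□ , 1ℚ) ∷ [ (pos u ∷ Y , 1ℚ) ]
  reorder = ++-cong (≈-refl {[ (□ , 1ℚ) ]}) (≈-clause-↭ 1ℚ (++-comm Y [ pos u ]))

atMostOneCost : ℕ → ℕ
atMostOneCost zero    = 0
atMostOneCost (suc n) = atMostOneCost n + (1 + (suc n + 1))

atMostOneCost≤ : ∀ n → atMostOneCost n ≤ n * (n + 2)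
atMostOneCost≤ zero    = z≤n
atMostOneCost≤ (suc n) = begin
  atMostOneCost n + (1 + (suc n + 1))    ≤⟨ ℕ.+-monoˡ-≤ (1 + (suc n + 1)) (atMostOneCost≤ n) ⟩
  n * (n + 2) + (1 + (suc n + 1))        ≤⟨ ℕ.m≤m+n _ n ⟩
  n * (n + 2) + (1 + (suc n + 1)) + n    ≡⟨ expand n ⟩
  suc n * (suc n + 2)                    ∎
  where
  open ℕ.≤-Reasoning
  expand : ∀ n → n * (n + 2) + (1 + (suc n + 1)) + n ≡ suc n * (suc n + 2)
  expand = solve-∀

⊢-atMostOne : ∀ v vs → Unique (v ∷ vs) →
  positiveUnits (v ∷ vs) ++ atMostOne (v ∷ vs)
    ⊢[ atMostOneCost (length vs) ] □[ length vs ] ++ [ (map pos (v ∷ vs) , 1ℚ) ]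
⊢-atMostOne v []       _ = ⊢-reflexive (≈-sym (++-cong □[0]≈[] ≈-refl))
⊢-atMostOne v (w ∷ ws) uniq@(_ ∷ uniqᵥₛ) =
  ⊢-respˡ (≈-sym peelOff)
    (⊢-trans {atMostOneCost (length ws)} (⊢-frameʳ nonNegS (⊢-atMostOne w ws uniqᵥₛ))
      (⊢-respˡ (≈-sym (++-assoc-≈ □[ length ws ] [ (Y , 1ℚ) ] S))
        (⊢-respʳ collect
          (⊢-frameˡ (NonNeg-□ (length ws)) (⊢-absorbUnit v (w ∷ ws) (Unique[x∷xs]⇒x∉xs uniq))))))
  where
  Y = map pos (w ∷ ws)
  unitV : WClause
  unitV = pos v ∷ [] , 1ℚ
  S : Formula
  S = unitV ∷ exclusions v (w ∷ ws)
  nonNegS : NonNeg S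
  nonNegS = 0≤1 ∷ NonNeg-unitWeights (λ y → neg v ∷ neg y ∷ []) (w ∷ ws)
  peelOff : positiveUnits (v ∷ w ∷ ws) ++ atMostOne (v ∷ w ∷ ws)
          ≈ (positiveUnits (w ∷ ws) ++ atMostOne (w ∷ ws)) ++ S
  peelOff = ≈-trans
    (++-cong (≈-refl {[ unitV ]}) (x∙yz≈xz∙y (positiveUnits (w ∷ ws)) (exclusions v (w ∷ ws)) (atMostOne (w ∷ ws))))
    (x∙yz≈y∙xz [ unitV ] (positiveUnits (w ∷ ws) ++ atMostOne (w ∷ ws)) (exclusions v (w ∷ ws)))
  collect : □[ length ws ] ++ (□ , 1ℚ) ∷ [ (pos v ∷ Y , 1ℚ) ] ≈ □[ length (w ∷ ws) ] ++ [ (pos v ∷ Y , 1ℚ) ]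
  collect = ≈-trans (≈-sym (++-assoc-≈ □[ length ws ] [ (□ , 1ℚ) ] _)) (++-cong (□[suc] (length ws)) ≈-refl)

upFrom : ℕ → ℕ → List ℕ
upFrom a zero    = []
upFrom a (suc n) = a ∷ upFrom (suc a) n

applyUpTo≡upFrom : ∀ (f : ℕ → ℕ) a n → (∀ k → f k ≡ a + k) → applyUpTo f n ≡ upFrom a n
applyUpTo≡upFrom f a zero    f≗a+ = ≡.refl
applyUpTo≡upFrom f a (suc n) f≗a+ = cong₂ _∷_ (≡.trans (f≗a+ 0) (ℕ.+-identityʳ a))
  (applyUpTo≡upFrom (f ∘ suc) (suc a) n (λ k → ≡.trans (f≗a+ (suc k)) (ℕ.+-suc a k)))

range1≡upFrom : ∀ n → range1 n ≡ upFrom 1 n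
range1≡upFrom n = applyUpTo≡upFrom suc 1 n (λ _ → ≡.refl)

length-upFrom : ∀ a n → length (upFrom a n) ≡ n
length-upFrom a zero    = ≡.refl
length-upFrom a (suc n) = cong suc (length-upFrom (suc a) n)

Unique-upFrom : ∀ a n → Unique (upFrom a n)
Unique-upFrom a n = subst Unique (applyUpTo≡upFrom (λ k → a + k) a n (λ _ → ≡.refl))
  (applyUpTo⁺₁ (λ k → a + k) n (λ i<j _ → ℕ.<⇒≢ (ℕ.+-monoʳ-< a i<j)))

concatMap-singleton : ∀ {A B : Set} (f : A → B) (L : List A) → concatMap (λ a → [ f a ]) L ≡ map f L
concatMap-singleton f L = ≡.trans (≡.sym (List.concatMap-map [_] f L)) (List.concatMap-pure (map f L))

concatMap-++ : ∀ {A : Set} (F G : A → Formula) (L : List A) →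
               concatMap (λ a → F a ++ G a) L ≈ concatMap F L ++ concatMap G L
concatMap-++ F G []      = ≈-refl
concatMap-++ F G (a ∷ L) =
  ≈-trans (++-cong (≈-refl {F a ++ G a}) (concatMap-++ F G L)) (interchange (F a) (G a) _ _)

concatMap-cong-≈ : ∀ {A : Set} {F G : A → Formula} (L : List A) →
                   (∀ a → F a ≈ G a) → concatMap F L ≈ concatMap G L
concatMap-cong-≈ []      F≈G = ≈-refl
concatMap-cong-≈ (a ∷ L) F≈G = ++-cong (F≈G a) (concatMap-cong-≈ L F≈G)

concatMap-comm : ∀ {A B : Set} (I : List A) (J : List B) (F : A → B → Formula) →
  concatMap (λ j → concatMap (λ i → F i j) I) J ≈ concatMap (λ i → concatMap (λ j → F i j) J) I
concatMap-comm I []      F = ≈-sym (≡⇒≈ (vanish I))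
  where
  vanish : ∀ I → concatMap (λ i → concatMap (λ j → F i j) []) I ≡ []
  vanish []      = ≡.refl
  vanish (i ∷ I) = vanish I
concatMap-comm I (j ∷ J) F =
  ≈-trans (++-cong (≈-refl {concatMap (λ i → F i j) I}) (concatMap-comm I J F))
    (≈-sym (concatMap-++ (λ i → F i j) (λ i → concatMap (λ j → F i j) J) I))

-- Written exactly as in K, so that K m unfolds to it.
exclusionClauses : ℕ → ℕ → ℕ → List Clause
exclusionClauses m j i = map (λ i′ → neg (x i j) ∷ neg (x i′ j) ∷ []) (applyUpTo (λ k → i + suc k) (suc m ∸ i))

unitWeighted-exclusionClauses : ∀ m j a n → a + n ≡ suc (suc m) →
  map (_, 1ℚ) (concatMap (exclusionClauses m j) (upFrom a n)) ≡ atMostOne (map (λ i → x i j) (upFrom a n))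
unitWeighted-exclusionClauses m j a zero    _     = ≡.refl
unitWeighted-exclusionClauses m j a (suc n) a+n≡ = begin
  map (_, 1ℚ) (exclusionClauses m j a ++ concatMap (exclusionClauses m j) (upFrom (suc a) n))
    ≡⟨ List.map-++ (_, 1ℚ) (exclusionClauses m j a) _ ⟩
  map (_, 1ℚ) (exclusionClauses m j a) ++ map (_, 1ℚ) (concatMap (exclusionClauses m j) (upFrom (suc a) n))
    ≡⟨ cong₂ _++_ head (unitWeighted-exclusionClauses m j (suc a) n (≡.trans (≡.sym (ℕ.+-suc a n)) a+n≡)) ⟩
  exclusions (x a j) (map (λ i → x i j) (upFrom (suc a) n)) ++ atMostOne (map (λ i → x i j) (upFrom (suc a) n))
    ∎
  where
  open ≡.≡-Reasoning
  suc-m∸a≡n : suc m ∸ a ≡ n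
  suc-m∸a≡n = ≡.trans (cong (_∸ a) (≡.sym (ℕ.suc-injective (≡.trans (≡.sym (ℕ.+-suc a n)) a+n≡))))
                      (ℕ.m+n∸m≡n a n)
  laterPigeons : applyUpTo (λ k → a + suc k) (suc m ∸ a) ≡ upFrom (suc a) n
  laterPigeons = ≡.trans (cong (applyUpTo (λ k → a + suc k)) suc-m∸a≡n)
                         (applyUpTo≡upFrom _ (suc a) n (λ k → ℕ.+-suc a k))
  head : map (_, 1ℚ) (exclusionClauses m j a) ≡ exclusions (x a j) (map (λ i → x i j) (upFrom (suc a) n))
  head = begin
    map (_, 1ℚ) (map (λ i′ → neg (x a j) ∷ neg (x i′ j) ∷ []) (applyUpTo (λ k → a + suc k) (suc m ∸ a)))
      ≡⟨ cong (λ L → map (_, 1ℚ) (map (λ i′ → neg (x a j) ∷ neg (x i′ j) ∷ []) L)) laterPigeons ⟩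
    map (_, 1ℚ) (map (λ i′ → neg (x a j) ∷ neg (x i′ j) ∷ []) (upFrom (suc a) n))
      ≡⟨ List.map-∘ (upFrom (suc a) n) ⟨
    map (λ i′ → (neg (x a j) ∷ neg (x i′ j) ∷ [] , 1ℚ)) (upFrom (suc a) n)
      ≡⟨ List.map-∘ (upFrom (suc a) n) ⟩
    exclusions (x a j) (map (λ i → x i j) (upFrom (suc a) n))
      ∎

m*[[1+m]*1]≡m*m+m : ∀ m → m * (suc m * 1) ≡ m * m + m
m*[[1+m]*1]≡m*m+m = solve-∀

m*m+[1+m]*1≡m*m+m+1 : ∀ m → m * m + suc m * 1 ≡ m * m + m + 1
m*m+[1+m]*1≡m*m+m+1 = solve-∀

module Refutation (m : ℕ) where

  pigeons holes : List ℕ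
  pigeons = upFrom 1 (suc m)
  holes   = upFrom 1 m

  #pigeons : length pigeons ≡ suc m
  #pigeons = length-upFrom 1 (suc m)

  #holes : length holes ≡ m
  #holes = length-upFrom 1 m

  #emptyClauses : m * m + m ≡ length holes * (length pigeons * 1)
  #emptyClauses = ≡.sym (≡.trans (cong₂ (λ h p → h * (p * 1)) #holes #pigeons) (m*[[1+m]*1]≡m*m+m m))

  row column : ℕ → List Var
  row i    = map (λ j → x i j) holes
  column j = map (λ i → x i j) pigeons

  PigeonClauses HoleClauses : Formula
  PigeonClauses = map (λ i → (map pos (row i) , 1ℚ)) pigeons
  HoleClauses   = concatMap (atMostOne ∘ column) holes

  SPHP0≡ : SPHP0 m ≡ (PigeonClauses ++ HoleClauses) ++ □[ m * m + m ]
  SPHP0≡ = cong (_++ □[ m * m + m ])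
    (≡.trans (List.map-++ (_, 1ℚ) pigeonClauses exclusionClausesK) (cong₂ _++_ pigeons≡ holes≡))
    where
    pigeonClauses exclusionClausesK : List Clause
    pigeonClauses     = map (λ i → map (λ j → pos (x i j)) (range1 m)) (range1 (suc m))
    exclusionClausesK = concatMap (λ j → concatMap (exclusionClauses m j) (range1 (suc m))) (range1 m)
    pigeons≡ : map (_, 1ℚ) pigeonClauses ≡ PigeonClauses
    pigeons≡ = begin
      map (_, 1ℚ) pigeonClauses
        ≡⟨ List.map-∘ (range1 (suc m)) ⟨
      map (λ i → (map (λ j → pos (x i j)) (range1 m) , 1ℚ)) (range1 (suc m))
        ≡⟨ cong (map _) (range1≡upFrom (suc m)) ⟩
      map (λ i → (map (λ j → pos (x i j)) (range1 m) , 1ℚ)) pigeons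
        ≡⟨ List.map-cong (λ i → cong (_, 1ℚ)
             (≡.trans (cong (map (λ j → pos (x i j))) (range1≡upFrom m)) (List.map-∘ holes))) pigeons ⟩
      PigeonClauses
        ∎
      where open ≡.≡-Reasoning
    holes≡ : map (_, 1ℚ) exclusionClausesK ≡ HoleClauses
    holes≡ = begin
      map (_, 1ℚ) exclusionClausesK
        ≡⟨ List.map-concatMap (_, 1ℚ) _ (range1 m) ⟩
      concatMap (λ j → map (_, 1ℚ) (concatMap (exclusionClauses m j) (range1 (suc m)))) (range1 m)
        ≡⟨ cong (concatMap _) (range1≡upFrom m) ⟩
      concatMap (λ j → map (_, 1ℚ) (concatMap (exclusionClauses m j) (range1 (suc m)))) holes
        ≡⟨ List.concatMap-cong (λ j → ≡.trans
             (cong (λ is → map (_, 1ℚ) (concatMap (exclusionClauses m j) is)) (range1≡upFrom (suc m)))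
             (unitWeighted-exclusionClauses m j 1 (suc m) ≡.refl)) holes ⟩
      HoleClauses
        ∎
      where open ≡.≡-Reasoning

  posUnit negUnit literalPair : Var → Formula
  posUnit v     = [ (pos v ∷ [] , 1ℚ) ]
  negUnit v     = [ (neg v ∷ [] , 1ℚ) ]
  literalPair v = posUnit v ++ negUnit v

  LiteralPairs : Formula
  LiteralPairs = concatMap (λ j → concatMap (λ i → literalPair (x i j)) pigeons) holes

  ⊢-literalPair : ∀ v → □[ 1 ] ⊢[ 1 ] literalPair v
  ⊢-literalPair v = ⊢-split [] v (positive-nonTautological [ v ]) (positive∨neg-nonTautological [] v λ ())

  splitEmptyClause : □[ m * m + m ] ⊢[ length holes * (length pigeons * 1) ] LiteralPairs
  splitEmptyClause =
    ⊢-respˡ (≈-sym emptyClauses≈)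
      (⊢-concatMap _ _ holes
        (λ _ → NonNeg-concatMap _ pigeons λ _ → NonNeg-□ 1)
        (λ _ → NonNeg-concatMap _ pigeons λ _ → 0≤1 ∷ 0≤1 ∷ [])
        (λ j → ⊢-concatMap _ _ pigeons (λ _ → NonNeg-□ 1) (λ _ → 0≤1 ∷ 0≤1 ∷ []) (λ i → ⊢-literalPair (x i j))))
    where
    emptyClauses≈ : □[ m * m + m ] ≈ concatMap (λ j → concatMap (λ i → □[ 1 ]) pigeons) holes
    emptyClauses≈ = begin
      □[ m * m + m ]                                            ≡⟨ cong □[_] #emptyClauses ⟩
      □[ length holes * (length pigeons * 1) ]                  ≈⟨ □[*] holes _ ⟩
      concatMap (λ j → □[ length pigeons * 1 ]) holes           ≈⟨ concatMap-cong-≈ holes (λ _ → □[*] pigeons 1) ⟩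
      concatMap (λ j → concatMap (λ i → □[ 1 ]) pigeons) holes  ∎
      where open import Relation.Binary.Reasoning.Setoid ≈-setoid

  negativeUnits : List Var → Formula
  negativeUnits = map (λ y → (neg y ∷ [] , 1ℚ))

  PosLiterals NegLiterals : Formula
  PosLiterals = concatMap (positiveUnits ∘ column) holes
  NegLiterals = concatMap (negativeUnits ∘ row) pigeons

  LiteralPairs≈ : LiteralPairs ≈ PosLiterals ++ NegLiterals
  LiteralPairs≈ = begin
    LiteralPairs
      ≈⟨ concatMap-cong-≈ holes (λ j → concatMap-++ (λ i → posUnit (x i j)) (λ i → negUnit (x i j)) pigeons) ⟩
    concatMap (λ j → concatMap (λ i → posUnit (x i j)) pigeons ++ concatMap (λ i → negUnit (x i j)) pigeons) holes
      ≈⟨ concatMap-++ _ _ holes ⟩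
    concatMap (λ j → concatMap (λ i → posUnit (x i j)) pigeons) holes ++
    concatMap (λ j → concatMap (λ i → negUnit (x i j)) pigeons) holes
      ≈⟨ ++-cong (≡⇒≈ (List.concatMap-cong (λ _ → ≡.trans (concatMap-singleton _ pigeons) (List.map-∘ pigeons)) holes))
                 (concatMap-comm pigeons holes (λ i j → negUnit (x i j))) ⟩
    PosLiterals ++ concatMap (λ i → concatMap (λ j → negUnit (x i j)) holes) pigeons
      ≡⟨ cong (PosLiterals ++_)
           (List.concatMap-cong (λ _ → ≡.trans (concatMap-singleton _ holes) (List.map-∘ holes)) pigeons) ⟩
    PosLiterals ++ NegLiterals
      ∎
    where open import Relation.Binary.Reasoning.Setoid ≈-setoid

  pigeonInput : ℕ → Formula
  pigeonInput i = (map pos (row i) ++ [] , 1ℚ) ∷ negativeUnits (row i)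

  NonNeg-pigeonInput : ∀ i → NonNeg (pigeonInput i)
  NonNeg-pigeonInput i = 0≤1 ∷ NonNeg-unitWeights (λ y → neg y ∷ []) (row i)

  holeInput : ℕ → Formula
  holeInput j = positiveUnits (column j) ++ atMostOne (column j)

  HoleInputs PigeonInputs : Formula
  HoleInputs   = concatMap holeInput holes
  PigeonInputs = concatMap pigeonInput pigeons

  regroup : (PigeonClauses ++ HoleClauses) ++ LiteralPairs ≈ HoleInputs ++ PigeonInputs
  regroup = begin
    (PigeonClauses ++ HoleClauses) ++ LiteralPairs
      ≈⟨ ++-cong (++-comm-≈ PigeonClauses HoleClauses) LiteralPairs≈ ⟩
    (HoleClauses ++ PigeonClauses) ++ (PosLiterals ++ NegLiterals)
      ≈⟨ interchange HoleClauses PigeonClauses PosLiterals NegLiterals ⟩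
    (HoleClauses ++ PosLiterals) ++ (PigeonClauses ++ NegLiterals)
      ≈⟨ ++-cong holeInputs pigeonInputs ⟩
    HoleInputs ++ PigeonInputs
      ∎
    where
    open import Relation.Binary.Reasoning.Setoid ≈-setoid
    holeInputs : HoleClauses ++ PosLiterals ≈ HoleInputs
    holeInputs = ≈-sym (≈-trans (concatMap-++ (positiveUnits ∘ column) (atMostOne ∘ column) holes)
                                (++-comm-≈ PosLiterals HoleClauses))
    pigeonClauses≡ : concatMap (λ i → [ (map pos (row i) ++ [] , 1ℚ) ]) pigeons ≡ PigeonClauses
    pigeonClauses≡ = ≡.trans (concatMap-singleton _ pigeons)
      (List.map-cong (λ i → cong (_, 1ℚ) (List.++-identityʳ (map pos (row i)))) pigeons)
    pigeonInputs : PigeonClauses ++ NegLiterals ≈ PigeonInputs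
    pigeonInputs = ≈-sym (≈-trans (concatMap-++ (λ i → [ (map pos (row i) ++ [] , 1ℚ) ]) (negativeUnits ∘ row) pigeons)
                                  (++-cong (≡⇒≈ pigeonClauses≡) (≈-refl {NegLiterals})))

  holeOutput : ℕ → Formula
  holeOutput j = □[ m ] ++ [ (map pos (column j) , 1ℚ) ]

  ⊢-hole : ∀ j → holeInput j ⊢[ atMostOneCost m ] holeOutput j
  ⊢-hole j = subst (λ n → holeInput j ⊢[ atMostOneCost n ] □[ n ] ++ [ (map pos (column j) , 1ℚ) ])
    (≡.trans (List.length-map (λ i → x i j) (upFrom 2 m)) (length-upFrom 2 m))
    (⊢-atMostOne (x 1 j) (map (λ i → x i j) (upFrom 2 m)) (map⁺ (cong proj₁) (Unique-upFrom 1 (suc m))))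

  ⊢-pigeon : ∀ i → pigeonInput i ⊢[ m ] [ (□ , 1ℚ) ]
  ⊢-pigeon i = subst (λ n → pigeonInput i ⊢[ n ] [ (□ , 1ℚ) ])
    (≡.trans (List.length-map (λ j → x i j) holes) #holes)
    (⊢-resolvePositives [] (row i)
      (subst NonTautological (≡.sym (List.++-identityʳ (map pos (row i)))) (positive-nonTautological (row i))))

  HoleOutputs PigeonOutputs Leftover : Formula
  HoleOutputs   = concatMap holeOutput holes
  PigeonOutputs = concatMap (λ _ → [ (□ , 1ℚ) ]) pigeons
  Leftover      = concatMap (λ j → [ (map pos (column j) , 1ℚ) ]) holes

  NonNeg-HoleOutputs : NonNeg HoleOutputs
  NonNeg-HoleOutputs = NonNeg-concatMap holeOutput holes (λ _ → ++⁺ (NonNeg-□ m) (0≤1 ∷ []))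

  refuteHolesAndPigeons :
    HoleInputs ++ PigeonInputs ⊢[ length holes * atMostOneCost m + length pigeons * m ] HoleOutputs ++ PigeonOutputs
  refuteHolesAndPigeons =
    ⊢-++ (NonNeg-concatMap pigeonInput pigeons NonNeg-pigeonInput) NonNeg-HoleOutputs
      (⊢-concatMap holeInput holeOutput holes
        (λ j → ++⁺ (NonNeg-unitWeights (λ v → pos v ∷ []) (column j)) (NonNeg-atMostOne (column j)))
        (λ _ → ++⁺ (NonNeg-□ m) (0≤1 ∷ [])) ⊢-hole)
      (⊢-concatMap pigeonInput _ pigeons NonNeg-pigeonInput (λ _ → 0≤1 ∷ []) ⊢-pigeon)

  collect : HoleOutputs ++ PigeonOutputs ≈ □[ m * m + m + 1 ] ++ Leftover
  collect = begin
    HoleOutputs ++ PigeonOutputs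
      ≈⟨ ++-cong (concatMap-++ (λ _ → □[ m ]) (λ j → [ (map pos (column j) , 1ℚ) ]) holes) ≈-refl ⟩
    (concatMap (λ _ → □[ m ]) holes ++ Leftover) ++ PigeonOutputs
      ≈⟨ xy∙z≈xz∙y (concatMap (λ _ → □[ m ]) holes) Leftover PigeonOutputs ⟩
    (concatMap (λ _ → □[ m ]) holes ++ PigeonOutputs) ++ Leftover
      ≈⟨ ++-cong (++-cong (≈-sym (□[*] holes m)) (≈-sym (□[*] pigeons 1))) (≈-refl {Leftover}) ⟩
    (□[ length holes * m ] ++ □[ length pigeons * 1 ]) ++ Leftover
      ≈⟨ ++-cong (≈-sym (□[+] (length holes * m) (length pigeons * 1))) (≈-refl {Leftover}) ⟩
    □[ length holes * m + length pigeons * 1 ] ++ Leftover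
      ≡⟨ cong (λ k → □[ k ] ++ Leftover)
           (≡.trans (cong₂ (λ h p → h * m + p * 1) #holes #pigeons) (m*m+[1+m]*1≡m*m+m+1 m)) ⟩
    □[ m * m + m + 1 ] ++ Leftover
      ∎
    where open import Relation.Binary.Reasoning.Setoid ≈-setoid

  cost : ℕ
  cost = m * (suc m * 1) + (m * atMostOneCost m + suc m * m)

  SPHP0⊢□ : SPHP0 m ⊢[ cost ] □[ m * m + m + 1 ]
  SPHP0⊢□ = subst (λ e → SPHP0 m ⊢[ e ] □[ m * m + m + 1 ])
    (cong₂ (λ h p → h * (p * 1) + (h * atMostOneCost m + p * m)) #holes #pigeons)
    (⊢-respˡ (≡⇒≈ (≡.sym SPHP0≡))
      (⊢-trans (⊢-frameˡ nonNegClauses splitEmptyClause)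
        (⊢-respˡ (≈-sym regroup)
          (⊢-weaken collect (NonNeg-concatMap _ holes λ _ → 0≤1 ∷ []) refuteHolesAndPigeons))))
    where
    nonNegClauses : NonNeg (PigeonClauses ++ HoleClauses)
    nonNegClauses = ++⁺ (NonNeg-unitWeights (λ i → map pos (row i)) pigeons)
                        (NonNeg-concatMap (atMostOne ∘ column) holes (λ j → NonNeg-atMostOne (column j)))

cost≤7m³ : ∀ m → 1 ≤ m → Refutation.cost m ≤ 7 * m ^ 3
cost≤7m³ m@(suc t) _ = begin
  m * (suc m * 1) + (m * atMostOneCost m + suc m * m)
    ≤⟨ ℕ.+-monoʳ-≤ (m * (suc m * 1)) (ℕ.+-monoˡ-≤ (suc m * m) (ℕ.*-monoʳ-≤ m (atMostOneCost≤ m))) ⟩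
  m * (suc m * 1) + (m * (m * (m + 2)) + suc m * m)
    ≤⟨ ℕ.m≤m+n _ (t * (6 * t * t + 14 * t + 8)) ⟩
  m * (suc m * 1) + (m * (m * (m + 2)) + suc m * m) + t * (6 * t * t + 14 * t + 8)
    ≡⟨ slack t ⟩
  7 * m ^ 3
    ∎
  where
  open ℕ.≤-Reasoning
  slack : ∀ t → suc t * (suc (suc t) * 1) + (suc t * (suc t * (suc t + 2)) + suc (suc t) * suc t)
                + t * (6 * t * t + 14 * t + 8) ≡ 7 * (suc t * (suc t * (suc t * 1)))
  slack = solve-∀

mainTheorem17 : ∃[ c ] ∃[ k ] (∀ (m : ℕ) → 1 ≤ m →
    ∃[ e ] (e ≤ c * m ^ k × Derives e (SPHP0 m) ((□ , ℕtoℚ (m * m + m + 1)) ∷ [])))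
mainTheorem17 = 7 , 3 , λ m 1≤m → Refutation.cost m , cost≤7m³ m 1≤m , ⊢⇒Derives (Refutation.SPHP0⊢□ m)
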